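{- Let $\mathcal{S}$ be the schedule produced by the Non-Interfering algorithm, with jobs numbered so that job $k$ is executed in the $k$-th position of $\mathcal{S}$ and has completion time $C_k$. Let $\mathcal{S}^*$ be an optimal (minimum makespan) schedule, let $\gamma(k)$ be the job executed in the $k$-th position of $\mathcal{S}^*$, and let $C_i^*$ be the completion time of job $i$ in $\mathcal{S}^*$. Call job $k$ critical if $C_k\le C_{\gamma(k)}^*$, and let $\ell=\max\{k\in\mathcal{J}:C_k\le C_{\gamma(k)}^*\}$ be the last critical job. Then for each $k\in\{\ell+1,\ldots,n\}$, $$\sum_{i=\ell+1}^k\alpha_i\le 2\left[\sum_{j=1}^k\alpha_{\gamma(j)}\right].$$
   Context: Problem: a single machine must process a set $\mathcal{J}=\{1,\ldots,n\}$ of jobs non-preemptively, at most one job at a time. Job $i$ has a release time $r_i\ge 0$ and a fixed processing time $\alpha_i\ge 0$, and there is a common deterioration rate $\beta>0$. If job $i$ starts at time $s_i\ge r_i$, its processing time is $\alpha_i+\beta s_i$ and it completes at $C_i=(1+\beta)s_i+\alpha_i$. A schedule is feasible if jobs do not overlap and $s_i\ge r_i$; the makespan is $\max_i C_i$. A job is pending at time $t$ if it is released by $t$ and has not started before $t$. Non-Interfering algorithm: each time $t$ the machine becomes available, let $i$ be a pending job with minimum $\alpha_i$. If there is a job $j$ with $\alpha_j<\alpha_i$ and $t<r_j<(1+\beta)t+\alpha_i$, the machine stays idle during $[t,r_j)$ and the rule is reapplied at time $r_j$; otherwise $i$ is started at time $t$.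
   Formalization: The release times $r_i$, fixed processing times $\alpha_i$, the deterioration rate $\beta$ and the start times of every schedule, including $\mathcal{S}^*$ and the schedules it is compared with, are rational. -}

module Defs where

open import Data.Nat as ℕ using (ℕ; zero; suc)
open import Data.Fin using (Fin; zero; suc; toℕ; inject₁)
open import Data.Fin.Properties using ()
open import Data.List using (List; foldr; allFin)
open import Data.Bool using (Bool; if_then_else_)
open import Data.Product using (Σ; ∃; _×_)
open import Data.Empty using (⊥)
open import Relation.Nullary.Decidable using (⌊_⌋)
open import Relation.Binary.PropositionalEquality using (_≡_)
open import Function.Definitions using (Injective)
open import Data.Rational using (ℚ; 0ℚ; 1ℚ; _+_; _*_; _≤_; _<_; _⊔_)

-- A schedule of n jobs: the job processed at each position, and the start
-- time of each job.  (Positions are 0-based Fin n.)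
record Schedule (n : ℕ) : Set where
  field
    order     : Fin n → Fin n          -- position ↦ job
    order-inj : Injective _≡_ _≡_ order
    start     : Fin n → ℚ              -- job ↦ start time s_j
open Schedule public

-- The problem instance: release times r, fixed parts α, common rate β.
module Instance {n : ℕ} (r α : Fin n → ℚ) (β : ℚ) where

  completion : Schedule n → Fin n → ℚ
  completion S j = (1ℚ + β) * start S j + α j

  Next : Fin n → Fin n → Set
  Next p q = toℕ q ≡ suc (toℕ p)

  Feasible : Schedule n → Set
  Feasible S = (∀ j → r j ≤ start S j)
             × (∀ p q → Next p q → completion S (order S p) ≤ start S (order S q))

  makespan : Schedule n → ℚ
  makespan S = foldr (λ j m → completion S j ⊔ m) 0ℚ (allFin n)

  Optimal : Schedule n → Set
  Optimal S = Feasible S × (∀ S′ → Feasible S′ → makespan S ≤ makespan S′)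

  -- One application of the Non-Interfering rule, started when the machine
  -- becomes available at time t with set U of not-yet-started jobs:
  -- NIStart U t s i  means: the rule (possibly after idling) starts job i at time s.
  data NIStart (U : Fin n → Set) : ℚ → ℚ → Fin n → Set where
    -- i pending with minimum α, no interfering job: start i at t
    run  : ∀ {t i} → U i → r i ≤ t
         → (∀ j → U j → r j ≤ t → α i ≤ α j)
         → (∀ j → α j < α i → t < r j → r j < (1ℚ + β) * t + α i → ⊥)
         → NIStart U t t i
    -- i pending with minimum α, j interferes: idle until r_j and reapply
    wait : ∀ {t s i i′ j} → U i → r i ≤ t
         → (∀ j′ → U j′ → r j′ ≤ t → α i ≤ α j′)
         → α j < α i → t < r j → r j < (1ℚ + β) * t + α i
         → NIStart U (r j) s i′
         → NIStart U t s i′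
    -- no pending job: idle until the next release time and reapply
    idle : ∀ {t s i′ j} → U j
         → (∀ j′ → U j′ → t < r j′)
         → (∀ j′ → U j′ → r j ≤ r j′)
         → NIStart U (r j) s i′
         → NIStart U t s i′

  Unstarted : Schedule n → Fin n → Fin n → Set
  Unstarted S p j = ∃ λ q → toℕ p ℕ.≤ toℕ q × order S q ≡ j

  available : Schedule n → Fin n → ℚ
  available S zero    = 0ℚ
  available S (suc q) = completion S (order S (inject₁ q))

  -- S is a schedule produced by the Non-Interfering algorithm (any tie-breaking)
  IsNonInterfering : Schedule n → Set
  IsNonInterfering S =
    ∀ p → NIStart (Unstarted S p) (available S p) (start S (order S p)) (order S p)

  sumPos : ℕ → ℕ → (Fin n → ℚ) → ℚ
  sumPos a b f = foldr (λ q acc → (if ⌊ a ℕ.≤? toℕ q ⌋ Data.Bool.∧ ⌊ toℕ q ℕ.≤? b ⌋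
                                    then f q else 0ℚ) + acc) 0ℚ (allFin n)

  Critical : Schedule n → Schedule n → Fin n → Set
  Critical S S* k = completion S (order S k) ≤ completion S* (order S* k)

{-# OPTIONS --safe #-}
-- Fix a threshold y and let d be the last position in (ℓ, k] at which the
-- Non-Interfering schedule S runs a job with α ≥ y.  A job with α < y that the
-- optimal schedule S* runs at a position q ≤ d is not still unstarted in S at
-- position d: non-interference would then release it no earlier than C_d, while
-- non-criticality of d gives r ≤ C*_q ≤ C*_d < C_d.  So among the first d + 1
-- positions S* runs at most as many jobs with α < y as S, hence at least as many
-- with α ≥ y.  Thus for every y, positions (ℓ, k] of S hold no more jobs with
-- α ≥ y than positions [0, k] of S*, and matching largest values greedily turns
-- this domination of tail counts into the inequality of sums, already with
-- constant 1 and using only feasibility of S*.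
module Submission where

open import Defs
open import Data.Nat using (suc) renaming (_<_ to _<ℕ_)
open import Data.Fin using (Fin; toℕ)
open import Data.Empty using (⊥)
open import Data.Rational using (ℚ; 0ℚ; 1ℚ; _+_; _*_; _≤_; _<_)

open import Level using (Level; 0ℓ)
open import Algebra.Bundles using (CommutativeMonoid)
import Algebra.Properties.CommutativeMonoid.Sum as MonoidSum
import Algebra.Properties.CommutativeSemigroup as CommutativeSemigroupProperties
open import Data.Bool using (if_then_else_; _∧_)
open import Data.Empty using (⊥-elim)
open import Data.Fin using (zero; suc; inject₁; punchOut)
open import Data.Fin.Properties using (_≟_; any?; injective⇒≤; punchOut-injective; toℕ-inject₁)
open import Data.Fin.Induction using (<-weakInduction-startingFrom)
open import Data.Fin.Permutation as Perm using (Permutation′; permutation; _⟨$⟩ʳ_; _∘ₚ_)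
open import Data.List using (foldr; tabulate)
open import Data.Nat as ℕ using (ℕ; zero; z≤n; s≤s)
import Data.Nat.Properties as ℕₚ
open import Data.Product using (∃; _×_; _,_; proj₁; proj₂)
import Data.Rational as ℚ
import Data.Rational.Properties as ℚₚ
open import Data.Rational.Solver using (module +-*-Solver)
open import Data.Sum using (inj₁; inj₂)
open import Function using (_∘_; id)
open import Function.Definitions using (Injective; Surjective)
open import Relation.Binary.Bundles using (Preorder; TotalPreorder)
open import Relation.Binary.PropositionalEquality
  using (_≡_; _≢_; refl; sym; trans; cong; cong₂; subst; subst₂)
open import Relation.Nullary using (Dec; yes; no; does; ¬_; ¬?; _×-dec_; contradiction)
open import Relation.Nullary.Decidable using (⌊_⌋; isYes≗does)
open import Relation.Unary using (Pred; Decidable; _∩_; ∁; _⊆_)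
open import Relation.Unary.Properties using (_∩?_; ∁?)

private variable
  a : Level
  n : ℕ

injective⇒surjective : {f : Fin n → Fin n} → Injective _≡_ _≡_ f → Surjective _≡_ _≡_ f
injective⇒surjective {suc m} {f} f-injective y with any? (λ x → f x ≟ y)
... | yes (x , fx≡y) = x , λ { refl → fx≡y }
... | no missed = contradiction (injective⇒≤ squeeze-injective) ℕₚ.1+n≰n
  where
  y≢f : ∀ x → y ≢ f x
  y≢f x y≡fx = missed (x , sym y≡fx)

  squeeze : Fin (suc m) → Fin m
  squeeze x = punchOut (y≢f x)

  squeeze-injective : Injective _≡_ _≡_ squeeze
  squeeze-injective eq = f-injective (punchOut-injective (y≢f _) (y≢f _) eq)

injective⇒permutation : {f : Fin n → Fin n} → Injective _≡_ _≡_ f → Permutation′ n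
injective⇒permutation {f = f} f-injective =
  permutation f (proj₁ ∘ onto) (λ y → proj₂ (onto y) refl)
                (λ x → f-injective (proj₂ (onto (f x)) refl))
  where onto = injective⇒surjective f-injective

infixl 6 _─_

-- The test  x ≢ i  comes first so that, away from i, the decision reduces
-- definitionally to that of P?; sums then unfold without rewriting.
_─_ : {P : Pred (Fin n) a} → Decidable P → (i : Fin n) → Decidable ((_≢ i) ∩ P)
(P? ─ i) = (λ x → ¬? (x ≟ i)) ∩? P?

module SubsetSum {c ℓ} (M : CommutativeMonoid c ℓ) where
  open CommutativeMonoid M renaming (refl to ≈-refl; sym to ≈-sym; trans to ≈-trans)
  open MonoidSum M using (sum; sum-permute)
  open CommutativeSemigroupProperties commutativeSemigroup using (interchange; x∙yz≈y∙xz)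

  select : {A : Set a} → Dec A → Carrier → Carrier
  select d x = if does d then x else ε

  select-yes : {A : Set a} (d : Dec A) {x : Carrier} → A → select d x ≈ x
  select-yes (yes _) _  = ≈-refl
  select-yes (no ¬a) a′ = contradiction a′ ¬a

  select-no : {A : Set a} (d : Dec A) {x : Carrier} → ¬ A → select d x ≈ ε
  select-no (yes a′) ¬a = contradiction a′ ¬a
  select-no (no _)   _  = ≈-refl

  select-split : {A B : Set a} (d : Dec A) (e : Dec B) {x : Carrier} →
                 select d x ≈ select (d ×-dec e) x ∙ select (d ×-dec ¬? e) x
  select-split (yes _) (yes _) = ≈-sym (identityʳ _)
  select-split (yes _) (no _)  = ≈-sym (identityˡ _)
  select-split (no _)  _       = ≈-sym (identityˡ ε)

  sumOver : {P : Pred (Fin n) a} → Decidable P → (Fin n → Carrier) → Carrier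
  sumOver P? f = sum (λ x → select (P? x) (f x))

  sumOver-∅ : {P : Pred (Fin n) a} (P? : Decidable P) (f : Fin n → Carrier) →
              (∀ x → ¬ P x) → sumOver P? f ≈ ε
  sumOver-∅ {zero}  P? f ∅ = ≈-refl
  sumOver-∅ {suc n} P? f ∅ =
    ≈-trans (∙-cong (select-no (P? zero) (∅ zero)) (sumOver-∅ (P? ∘ suc) (f ∘ suc) (∅ ∘ suc)))
            (identityˡ ε)

  sumOver-remove : {P : Pred (Fin n) a} (P? : Decidable P) (f : Fin n → Carrier) {i : Fin n} →
                   P i → sumOver P? f ≈ f i ∙ sumOver (P? ─ i) f
  sumOver-remove P? f {zero} Pi = ∙-cong (select-yes (P? zero) Pi) (≈-sym (identityˡ _))
  sumOver-remove P? f {suc i} Pi =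
    ≈-trans (∙-congˡ (sumOver-remove (P? ∘ suc) (f ∘ suc) Pi)) (x∙yz≈y∙xz _ _ _)

  sumOver-split : {P R : Pred (Fin n) a} (P? : Decidable P) (R? : Decidable R)
                  (f : Fin n → Carrier) →
                  sumOver P? f ≈ sumOver (P? ∩? R?) f ∙ sumOver (P? ∩? ∁? R?) f
  sumOver-split {zero}  P? R? f = ≈-sym (identityˡ ε)
  sumOver-split {suc n} P? R? f =
    ≈-trans (∙-cong (select-split (P? zero) (R? zero)) (sumOver-split (P? ∘ suc) (R? ∘ suc) (f ∘ suc)))
            (interchange _ _ _ _)

  sumOver-permute : {P : Pred (Fin n) a} (P? : Decidable P) (f : Fin n → Carrier)
                    (ρ : Permutation′ n) →
                    sumOver (P? ∘ (ρ ⟨$⟩ʳ_)) (f ∘ (ρ ⟨$⟩ʳ_)) ≈ sumOver P? f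
  sumOver-permute P? f ρ = ≈-sym (sum-permute (λ x → select (P? x) (f x)) ρ)

  foldr-tabulate : ∀ {A : Set a} (h : A → Carrier) (t : Fin n → A) →
                   foldr (λ x acc → h x ∙ acc) ε (tabulate t) ≡ sum (h ∘ t)
  foldr-tabulate {n = zero}  h t = refl
  foldr-tabulate {n = suc n} h t = cong (h (t zero) ∙_) (foldr-tabulate h (t ∘ suc))

open SubsetSum ℚₚ.+-0-commutativeMonoid using (select; sumOver; sumOver-remove; sumOver-∅; foldr-tabulate)
open MonoidSum ℚₚ.+-0-commutativeMonoid using (sum-cong-≗)
private module Counting = SubsetSum ℕₚ.+-0-commutativeMonoid

count : {P : Pred (Fin n) a} → Decidable P → ℕ
count P? = Counting.sumOver P? (λ _ → 1)

count-mono : {P Q : Pred (Fin n) a} (P? : Decidable P) (Q? : Decidable Q) →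
             P ⊆ Q → count P? ℕ.≤ count Q?
count-mono {zero}  P? Q? P⊆Q = z≤n
count-mono {suc n} P? Q? P⊆Q =
  ℕₚ.+-mono-≤ (head (P? zero) (Q? zero) P⊆Q) (count-mono (P? ∘ suc) (Q? ∘ suc) P⊆Q)
  where
  head : ∀ {A B : Set a} (d : Dec A) (e : Dec B) → (A → B) →
         Counting.select d 1 ℕ.≤ Counting.select e 1
  head (yes a′) (no ¬b) A⇒B = contradiction (A⇒B a′) ¬b
  head (yes _)  (yes _) _   = ℕₚ.≤-refl
  head (no _)   _       _   = z≤n

count-cong : {P Q : Pred (Fin n) a} (P? : Decidable P) (Q? : Decidable Q) →
             P ⊆ Q → Q ⊆ P → count P? ≡ count Q?
count-cong P? Q? P⊆Q Q⊆P = ℕₚ.≤-antisym (count-mono P? Q? P⊆Q) (count-mono Q? P? Q⊆P)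

count-witness : {P : Pred (Fin n) a} (P? : Decidable P) → 0 <ℕ count P? → ∃ P
count-witness P? 0<count with any? P?
... | yes found = found
... | no none   = contradiction (Counting.sumOver-∅ P? _ (λ x Px → none (x , Px))) (ℕₚ.>⇒≢ 0<count)

module _ {c ℓ₁ ℓ₂} (O : TotalPreorder c ℓ₁ ℓ₂) where
  open TotalPreorder O renaming (refl to ≲-refl; trans to ≲-trans)

  argmax : {P : Pred (Fin n) a} → Decidable P → (f : Fin n → Carrier) → ∃ P →
           ∃ λ m → P m × (∀ {x} → P x → f x ≲ f m)
  argmax {suc n} {P = P} P? f (x₀ , Px₀) with any? (P? ∘ suc)
  ... | no ¬tail =
    zero , only-zero x₀ Px₀ , λ { {zero} _ → ≲-refl ; {suc x} Px → contradiction (x , Px) ¬tail }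
    where
    only-zero : ∀ x → P x → P zero
    only-zero zero    Px = Px
    only-zero (suc x) Px = contradiction (x , Px) ¬tail
  ... | yes tail with argmax (P? ∘ suc) (f ∘ suc) tail | P? zero
  ...   | m , Pm , max | no ¬P0 = suc m , Pm , λ { {zero} P0 → contradiction P0 ¬P0 ; {suc x} Px → max Px }
  ...   | m , Pm , max | yes P0 with total (f zero) (f (suc m))
  ...     | inj₁ f0≲fm = suc m , Pm , λ { {zero} _ → f0≲fm ; {suc x} Px → max Px }
  ...     | inj₂ fm≲f0 = zero , P0 , λ { {zero} _ → ≲-refl ; {suc x} Px → ≲-trans (max Px) fm≲f0 }

atLeast? : (y : ℚ) (f : Fin n → ℚ) → Decidable (λ x → y ≤ f x)
atLeast? y f x = y ℚₚ.≤? f x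

tailCount : {P : Pred (Fin n) a} → Decidable P → (Fin n → ℚ) → ℚ → ℕ
tailCount P? f y = count (P? ∩? atLeast? y f)

tailCount-─ : {P : Pred (Fin n) a} (P? : Decidable P) (f : Fin n → ℚ) {y : ℚ} {i : Fin n} →
              P i → y ≤ f i → tailCount P? f y ≡ suc (tailCount (P? ─ i) f y)
tailCount-─ P? f {y} Pi y≤fi =
  trans (Counting.sumOver-remove (P? ∩? atLeast? y f) _ (Pi , y≤fi))
        (cong suc (count-cong ((P? ∩? atLeast? y f) ─ _) ((P? ─ _) ∩? atLeast? y f)
                              (λ { (x≢i , Px , y≤fx) → (x≢i , Px) , y≤fx })
                              (λ { ((x≢i , Px) , y≤fx) → x≢i , Px , y≤fx })))

sumOver-nonneg : {P : Pred (Fin n) a} (P? : Decidable P) (f : Fin n → ℚ) →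
                 (∀ {x} → P x → 0ℚ ≤ f x) → 0ℚ ≤ sumOver P? f
sumOver-nonneg {zero}  P? f f≥0 = ℚₚ.≤-refl
sumOver-nonneg {suc n} {P = P} P? f f≥0 =
  ℚₚ.+-mono-≤ (head (P? zero)) (sumOver-nonneg (P? ∘ suc) (f ∘ suc) f≥0)
  where
  head : (d : Dec (P zero)) → 0ℚ ≤ select d (f zero)
  head (yes P0) = f≥0 P0
  head (no _)   = ℚₚ.≤-refl

sumOver-mono-tailCount : {P Q : Pred (Fin n) a} (P? : Decidable P) (Q? : Decidable Q)
                         {f g : Fin n → ℚ} →
                         (∀ {x} → Q x → 0ℚ ≤ g x) →
                         (∀ y → tailCount P? f y ℕ.≤ tailCount Q? g y) →
                         sumOver P? f ≤ sumOver Q? g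
sumOver-mono-tailCount {n = n} {a = a} P? Q? {f} {g} = go (count P?) P? Q? refl
  where
  go : ∀ c {P Q : Pred (Fin n) a} (P? : Decidable P) (Q? : Decidable Q) → count P? ≡ c →
       (∀ {x} → Q x → 0ℚ ≤ g x) → (∀ y → tailCount P? f y ℕ.≤ tailCount Q? g y) →
       sumOver P? f ≤ sumOver Q? g
  go zero {P} P? Q? count≡0 g≥0 _ = begin
    sumOver P? f  ≡⟨ sumOver-∅ P? f empty ⟩
    0ℚ            ≤⟨ sumOver-nonneg Q? g g≥0 ⟩
    sumOver Q? g  ∎
    where
    open ℚₚ.≤-Reasoning
    empty : ∀ x → ¬ P x
    empty x Px = ℕₚ.0≢1+n (trans (sym count≡0) (Counting.sumOver-remove P? _ Px))
  go (suc c) {P} P? Q? count≡1+c g≥0 dominated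
    with i , Pi , f≤fi ← argmax ℚₚ.≤-totalPreorder P? f
                           (count-witness P? (subst (0 <ℕ_) (sym count≡1+c) (s≤s z≤n)))
    with j , Qj , fi≤gj ← count-witness (Q? ∩? atLeast? (f i) g)
                           (ℕₚ.<-≤-trans (subst (0 <ℕ_) (sym (tailCount-─ P? f Pi ℚₚ.≤-refl))
                                                (s≤s z≤n))
                                         (dominated (f i)))
    = begin
    sumOver P? f              ≡⟨ sumOver-remove P? f Pi ⟩
    f i + sumOver (P? ─ i) f  ≤⟨ ℚₚ.+-mono-≤ fi≤gj rest ⟩
    g j + sumOver (Q? ─ j) g  ≡⟨ sym (sumOver-remove Q? g Qj) ⟩
    sumOver Q? g              ∎
    where
    open ℚₚ.≤-Reasoning
    count≡c : count (P? ─ i) ≡ c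
    count≡c = ℕₚ.suc-injective (trans (sym (Counting.sumOver-remove P? _ Pi)) count≡1+c)

    dominated′ : ∀ y → tailCount (P? ─ i) f y ℕ.≤ tailCount (Q? ─ j) g y
    dominated′ y with y ℚₚ.≤? f i
    ... | yes y≤fi = ℕ.s≤s⁻¹ (subst₂ ℕ._≤_ (tailCount-─ P? f Pi y≤fi)
                                           (tailCount-─ Q? g Qj (ℚₚ.≤-trans y≤fi fi≤gj)) (dominated y))
    ... | no y≰fi  =
      subst (ℕ._≤ _) (sym (Counting.sumOver-∅ ((P? ─ i) ∩? atLeast? y f) _ above-i-none)) z≤n
      where
      above-i-none : ∀ x → ¬ (((x ≢ i) × P x) × y ≤ f x)
      above-i-none x ((_ , Px) , y≤fx) = y≰fi (ℚₚ.≤-trans y≤fx (f≤fi Px))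

    rest : sumOver (P? ─ i) f ≤ sumOver (Q? ─ j) g
    rest = go c (P? ─ i) (Q? ─ j) count≡c (g≥0 ∘ proj₂) dominated′

count-∩-≤-via-∁ : {P R S : Pred (Fin n) a} (P? : Decidable P) (R? : Decidable R)
                  (S? : Decidable S) →
                  count (P? ∩? ∁? S?) ℕ.≤ count (P? ∩? ∁? R?) →
                  count (P? ∩? R?) ℕ.≤ count (P? ∩? S?)
count-∩-≤-via-∁ P? R? S? fewer-outside = ℕₚ.+-cancelʳ-≤ _ _ _ (begin
  count (P? ∩? R?) ℕ.+ count (P? ∩? ∁? R?)  ≡⟨ sym (Counting.sumOver-split P? R? _) ⟩
  count P?                                  ≡⟨ Counting.sumOver-split P? S? _ ⟩
  count (P? ∩? S?) ℕ.+ count (P? ∩? ∁? S?)  ≤⟨ ℕₚ.+-monoʳ-≤ (count (P? ∩? S?)) fewer-outside ⟩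
  count (P? ∩? S?) ℕ.+ count (P? ∩? ∁? R?)  ∎)
  where open ℕₚ.≤-Reasoning

Between : ℕ → ℕ → Pred (Fin n) 0ℓ
Between lo hi q = lo ℕ.≤ toℕ q × toℕ q ℕ.≤ hi

between? : ∀ lo hi → Decidable (Between {n} lo hi)
between? lo hi q = (lo ℕ.≤? toℕ q) ×-dec (toℕ q ℕ.≤? hi)

module _ (w : Fin n → ℚ) (π γ : Permutation′ n) (ℓ : ℕ)
         (smaller-before : ∀ {p q p′} → ℓ <ℕ toℕ p → toℕ q ℕ.≤ toℕ p →
                           w (γ ⟨$⟩ʳ q) < w (π ⟨$⟩ʳ p) →
                           π ⟨$⟩ʳ p′ ≡ γ ⟨$⟩ʳ q → toℕ p′ <ℕ toℕ p)
  where

  private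
    wπ wγ : Fin n → ℚ
    wπ = w ∘ (π ⟨$⟩ʳ_)
    wγ = w ∘ (γ ⟨$⟩ʳ_)

    window : ∀ k y → Decidable (Between (suc ℓ) k ∩ (λ p → y ≤ wπ p))
    window k y = between? (suc ℓ) k ∩? atLeast? y wπ

    prefix : ∀ hi → Decidable (Between {n} 0 hi)
    prefix = between? 0

  tailCount-window≤tailCount-prefix : ∀ k y →
    tailCount (between? (suc ℓ) k) wπ y ℕ.≤ tailCount (between? 0 k) wγ y
  tailCount-window≤tailCount-prefix k y with any? (window k y)
  ... | no none =
    subst (ℕ._≤ _) (sym (Counting.sumOver-∅ (window k y) _ (λ p inside → none (p , inside)))) z≤n
  ... | yes found
    with d , ((ℓ<d , d≤k) , y≤wπd) , last ← argmax ℕₚ.≤-totalPreorder (window k y) toℕ found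
    = begin
    tailCount (between? (suc ℓ) k) wπ y
      ≤⟨ count-mono (window k y) (prefix (toℕ d) ∩? atLeast? y wπ)
                    (λ inside → (z≤n , last inside) , proj₂ inside) ⟩
    tailCount (prefix (toℕ d)) wπ y
      ≤⟨ count-∩-≤-via-∁ (prefix (toℕ d)) (atLeast? y wπ) (atLeast? y wγ) fewer-small ⟩
    tailCount (prefix (toℕ d)) wγ y
      ≤⟨ count-mono (prefix (toℕ d) ∩? atLeast? y wγ) (prefix k ∩? atLeast? y wγ)
                    (λ { ((_ , q≤d) , big) → (z≤n , ℕₚ.≤-trans q≤d d≤k) , big }) ⟩
    tailCount (prefix k) wγ y
      ∎
    where
    open ℕₚ.≤-Reasoning

    small-γ : Decidable (Between 0 (toℕ d) ∩ ∁ (λ q → y ≤ wγ q))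
    small-γ = prefix (toℕ d) ∩? ∁? (atLeast? y wγ)

    small-π : Decidable (Between 0 (toℕ d) ∩ ∁ (λ p → y ≤ wπ p))
    small-π = prefix (toℕ d) ∩? ∁? (atLeast? y wπ)

    -- ρ q is the π-position of the job that γ places at q.
    ρ : Permutation′ n
    ρ = γ ∘ₚ Perm.flip π

    moved : ∀ {q} → (Between 0 (toℕ d) ∩ ∁ (λ q → y ≤ wγ q)) q →
            (Between 0 (toℕ d) ∩ ∁ (λ p → y ≤ wπ p)) (ρ ⟨$⟩ʳ q)
    moved ((_ , q≤d) , small) =
      (z≤n , ℕₚ.<⇒≤ (smaller-before ℓ<d q≤d (ℚₚ.<-≤-trans (ℚₚ.≰⇒> small) y≤wπd)
                                    (Perm.inverseʳ π))) ,
      subst (λ j → ¬ y ≤ w j) (sym (Perm.inverseʳ π)) small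

    fewer-small : count small-γ ℕ.≤ count small-π
    fewer-small = begin
      count small-γ                  ≤⟨ count-mono small-γ (small-π ∘ (ρ ⟨$⟩ʳ_)) moved ⟩
      count (small-π ∘ (ρ ⟨$⟩ʳ_))   ≡⟨ Counting.sumOver-permute small-π _ ρ ⟩
      count small-π                  ∎

module _ {c ℓ₁ ℓ₂} (O : Preorder c ℓ₁ ℓ₂) where
  open Preorder O renaming (refl to ≲-refl; trans to ≲-trans)

  stepwise-monotone : (f : Fin n → Carrier) → (∀ p q → toℕ q ≡ suc (toℕ p) → f p ≲ f q) →
                      ∀ {p q} → toℕ p ℕ.≤ toℕ q → f p ≲ f q
  stepwise-monotone {suc n} f step {p} =
    <-weakInduction-startingFrom (λ q → f p ≲ f q) ≲-refl
      (λ i f≲ → ≲-trans f≲ (step (inject₁ i) (suc i) (cong suc (sym (toℕ-inject₁ i)))))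

x≤[1+b]x+c : ∀ {b x c} → 0ℚ ≤ b → 0ℚ ≤ x → 0ℚ ≤ c → x ≤ (1ℚ + b) * x + c
x≤[1+b]x+c {b} {x} {c} 0≤b 0≤x 0≤c = begin
  x                 ≡⟨ sym (ℚₚ.+-identityʳ x) ⟩
  x + 0ℚ            ≤⟨ ℚₚ.+-monoʳ-≤ x (ℚₚ.+-mono-≤ 0≤bx 0≤c) ⟩
  x + (b * x + c)   ≡⟨ solve 3 (λ b x c → x :+ (b :* x :+ c) := (con 1ℚ :+ b) :* x :+ c) refl b x c ⟩
  (1ℚ + b) * x + c  ∎
  where
  open ℚₚ.≤-Reasoning
  open +-*-Solver
  0≤bx : 0ℚ ≤ b * x
  0≤bx = subst (_≤ b * x) (ℚₚ.*-zeroˡ x) (ℚₚ.*-monoʳ-≤-nonNeg x {{ℚ.nonNegative 0≤x}} 0≤b)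

x≤2x : ∀ {x} → 0ℚ ≤ x → x ≤ (1ℚ + 1ℚ) * x
x≤2x {x} 0≤x = subst (x ≤_) (ℚₚ.+-identityʳ _) (x≤[1+b]x+c (ℚₚ.nonNegative⁻¹ 1ℚ) 0≤x ℚₚ.≤-refl)

module InstanceProperties (r α : Fin n → ℚ) (β : ℚ) where
  open Instance r α β

  NIStart-smaller⇒completion≤release : ∀ {U t s i} → NIStart U t s i →
                                       ∀ {j} → U j → α j < α i → (1ℚ + β) * s + α i ≤ r j
  NIStart-smaller⇒completion≤release (run {t} {i} _ _ minimal no-interference) {j} Uj αj<αi
    with r j ℚₚ.≤? t
  ... | yes rj≤t = contradiction (ℚₚ.<-≤-trans αj<αi (minimal j Uj rj≤t)) (ℚₚ.<-irrefl refl)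
  ... | no rj≰t with r j ℚₚ.<? (1ℚ + β) * t + α i
  ...   | yes interferes = ⊥-elim (no-interference j αj<αi (ℚₚ.≰⇒> rj≰t) interferes)
  ...   | no ¬interferes = ℚₚ.≮⇒≥ ¬interferes
  NIStart-smaller⇒completion≤release (wait _ _ _ _ _ _ next) = NIStart-smaller⇒completion≤release next
  NIStart-smaller⇒completion≤release (idle _ _ _ next)       = NIStart-smaller⇒completion≤release next

  sumPos≡sumOver : ∀ lo hi f → sumPos lo hi f ≡ sumOver (between? lo hi) f
  sumPos≡sumOver lo hi f =
    trans (foldr-tabulate summand id)
          (sum-cong-≗ {x = summand} {y = λ q → select (between? lo hi q) (f q)}
                      (λ q → cong₂ (λ u v → if u ∧ v then f q else 0ℚ)
                                   (isYes≗does (lo ℕ.≤? toℕ q)) (isYes≗does (toℕ q ℕ.≤? hi))))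
    where
    summand : Fin n → ℚ
    summand q = if ⌊ lo ℕ.≤? toℕ q ⌋ ∧ ⌊ toℕ q ℕ.≤? hi ⌋ then f q else 0ℚ

  module _ (r≥0 : ∀ j → 0ℚ ≤ r j) (α≥0 : ∀ j → 0ℚ ≤ α j) (β≥0 : 0ℚ ≤ β) where

    start≤completion : ∀ S → Feasible S → ∀ j → start S j ≤ completion S j
    start≤completion _ (released , _) j = x≤[1+b]x+c β≥0 (ℚₚ.≤-trans (r≥0 j) (released j)) (α≥0 j)

    completion-monotone : ∀ S → Feasible S → ∀ {p q} → toℕ p ℕ.≤ toℕ q →
                          completion S (order S p) ≤ completion S (order S q)
    completion-monotone S feasible@(_ , no-overlap) =
      stepwise-monotone (TotalPreorder.preorder ℚₚ.≤-totalPreorder) (completion S ∘ order S)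
        (λ p q next → ℚₚ.≤-trans (no-overlap p q next) (start≤completion S feasible (order S q)))

    smaller-before : ∀ S S* → IsNonInterfering S → Feasible S* → (ℓ : Fin n) →
                     (∀ k → toℕ ℓ <ℕ toℕ k → Critical S S* k → ⊥) →
                     ∀ {p q p′} → toℕ ℓ <ℕ toℕ p → toℕ q ℕ.≤ toℕ p →
                     α (order S* q) < α (order S p) → order S p′ ≡ order S* q → toℕ p′ <ℕ toℕ p
    smaller-before S S* ni feasible* ℓ noncritical {p} {q} {p′} ℓ<p q≤p smaller same =
      ℕₚ.≰⇒> λ p≤p′ → ℚₚ.<-irrefl refl (begin-strict
        completion S (order S p)     ≤⟨ NIStart-smaller⇒completion≤release (ni p) (p′ , p≤p′ , same)
                                                                             smaller ⟩
        r (order S* q)               ≤⟨ proj₁ feasible* (order S* q) ⟩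
        start S* (order S* q)        ≤⟨ start≤completion S* feasible* (order S* q) ⟩
        completion S* (order S* q)   ≤⟨ completion-monotone S* feasible* q≤p ⟩
        completion S* (order S* p)   <⟨ ℚₚ.≰⇒> (noncritical p ℓ<p) ⟩
        completion S (order S p)     ∎)
      where open ℚₚ.≤-Reasoning hiding (start)

lemma10 : ∀ {n} (r α : Fin n → ℚ) (β : ℚ)
    → (∀ j → 0ℚ ≤ r j) → (∀ j → 0ℚ ≤ α j) → 0ℚ < β
    → (S S* : Schedule n)
    → Instance.Feasible r α β S → Instance.IsNonInterfering r α β S
    → Instance.Optimal r α β S*
    → (ℓ : Fin n) → Instance.Critical r α β S S* ℓ
    → (∀ (k : Fin n) → toℕ ℓ <ℕ toℕ k → Instance.Critical r α β S S* k → ⊥)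
    → ∀ (k : Fin n) → toℕ ℓ <ℕ toℕ k
    → Instance.sumPos r α β (suc (toℕ ℓ)) (toℕ k) (λ q → α (order S q))
      ≤ (1ℚ + 1ℚ) * Instance.sumPos r α β 0 (toℕ k) (λ q → α (order S* q))
lemma10 {n} r α β r≥0 α≥0 0<β S S* _ ni (feasible* , _) ℓ _ noncritical k _ = begin
  sumPos (suc (toℕ ℓ)) (toℕ k) αS  ≡⟨ sumPos≡sumOver (suc (toℕ ℓ)) (toℕ k) αS ⟩
  sumOver window αS                 ≤⟨ sumOver-mono-tailCount window prefix (λ _ → α≥0 _) dominated ⟩
  sumOver prefix αS*                ≤⟨ x≤2x (sumOver-nonneg prefix αS* (λ _ → α≥0 _)) ⟩
  (1ℚ + 1ℚ) * sumOver prefix αS*    ≡⟨ cong ((1ℚ + 1ℚ) *_) (sym (sumPos≡sumOver 0 (toℕ k) αS*)) ⟩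
  (1ℚ + 1ℚ) * sumPos 0 (toℕ k) αS*  ∎
  where
  open Instance r α β
  open InstanceProperties r α β
  open ℚₚ.≤-Reasoning

  αS αS* : Fin n → ℚ
  αS q = α (order S q)
  αS* q = α (order S* q)

  window : Decidable (Between (suc (toℕ ℓ)) (toℕ k))
  window = between? (suc (toℕ ℓ)) (toℕ k)

  prefix : Decidable (Between 0 (toℕ k))
  prefix = between? 0 (toℕ k)

  dominated : ∀ y → tailCount window αS y ℕ.≤ tailCount prefix αS* y
  dominated =
    tailCount-window≤tailCount-prefix α (injective⇒permutation (order-inj S))
      (injective⇒permutation (order-inj S*)) (toℕ ℓ)
      (smaller-before r≥0 α≥0 (ℚₚ.<⇒≤ 0<β) S S* ni feasible* ℓ noncritical) (toℕ k)
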